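{- Let $G$ be a simple graph with $n \geq 5$ vertices and $m$ edges, with degree sequence $\Delta = d_1 \geq d_2 \geq \cdots \geq d_n = \delta > 0$. Then for any pairwise distinct indices $j, k, l, p \in \{1, \dots, n\}$, \[ M_1(G) \geq d_j^2 + d_k^2 + \frac{(2m - d_j - d_k)^2}{n-2} + \frac{1}{2}(d_l - d_p)^2 + \frac{2(n-2)}{n-4}\left(\frac{2m - d_j - d_k}{n-2} - \frac{d_l + d_p}{2}\right)^2. \]
   Context: $M_1(G) = \sum_{i=1}^n d_i^2$, where $d_i$ is the degree of vertex $v_i$. -}

module Defs where

open import Data.Nat using (ℕ; zero; suc; _<ᵇ_; _*_)
open import Data.Bool using (Bool; true; false; if_then_else_; _∧_)
open import Data.Fin using (Fin; toℕ)
open import Data.List using (List; map; allFin)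
open import Data.Nat.ListAction using (sum)
open import Data.Rational using (ℚ; 0ℚ)
import Data.Rational as ℚ
import Data.Integer as ℤ
open import Relation.Binary.PropositionalEquality using (_≡_)

record SimpleGraph (n : ℕ) : Set where
  field
    adj     : Fin n → Fin n → Bool
    symm    : ∀ i j → adj i j ≡ adj j i
    irrefl  : ∀ i → adj i i ≡ false

open SimpleGraph public

Σᵥ : {n : ℕ} → (Fin n → ℕ) → ℕ
Σᵥ {n} f = sum (map f (allFin n))

⟦_⟧ : Bool → ℕ
⟦ b ⟧ = if b then 1 else 0

degree : {n : ℕ} → SimpleGraph n → Fin n → ℕ
degree G i = Σᵥ (λ j → ⟦ adj G i j ⟧)

edges : {n : ℕ} → SimpleGraph n → ℕ
edges G = Σᵥ (λ i → Σᵥ (λ j → ⟦ (toℕ i <ᵇ toℕ j) ∧ adj G i j ⟧))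

M₁ : {n : ℕ} → SimpleGraph n → ℕ
M₁ G = Σᵥ (λ i → degree G i * degree G i)

-- division of a rational by a natural number (only used with positive
-- denominators; the value at 0 is an irrelevant convention)
_÷ℕ_ : ℚ → ℕ → ℚ
q ÷ℕ zero    = 0ℚ
q ÷ℕ (suc k) = q ℚ.* (ℤ.+ 1 ℚ./ suc k)

ℕ→ℚ : ℕ → ℚ
ℕ→ℚ n = ℤ.+ n ℚ./ 1

-- Split off the vertices j, k, l, p: M₁ = d_j² + d_k² + d_l² + d_p² + Σ' d_i² and, by the
-- handshake lemma, 2m = d_j + d_k + d_l + d_p + U, where Σ' ranges over the other K = n − 4
-- vertices and U = Σ' d_i.  Writing N = n − 2 = K + 2 and d_l² + d_p² = ½(d_l + d_p)² + ½(d_l − d_p)²,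
-- the right-hand side expands to exactly d_j² + d_k² + d_l² + d_p² + U²/K, so the bound is the
-- Cauchy–Schwarz inequality U²/K ≤ Σ' d_i².
module Submission where

open import Defs
open import Data.Nat using (ℕ; _≤_; _<_; _∸_)
open import Data.Fin using (Fin)
open import Data.Rational using (ℚ; _+_; _-_; _*_; _≥_; ½)
open import Relation.Binary.PropositionalEquality using (_≢_)

open import Algebra.Bundles using (CommutativeMonoid; Ring)
import Algebra.Properties.CommutativeMonoid.Sum as CommutativeMonoidSum
import Algebra.Properties.Semiring.Mult as SemiringMult
import Algebra.Properties.Semiring.Sum as SemiringSum
open import Data.Bool using (true; false; _∧_; T)
open import Data.Empty using (⊥-elim)
open import Data.Fin using (zero; suc; toℕ; punchOut)
open import Data.Fin.Properties using (toℕ-injective; punchOut-injective; punchIn-punchOut)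
import Data.Integer as ℤ using (+_; _+_)
import Data.Integer.Properties as ℤ
open import Data.List using (tabulate)
open import Data.List.Properties using (map-tabulate)
open import Data.Nat using (zero; suc; s≤s; z≤n; _<ᵇ_)
open import Data.Nat.Coprimality using (1-coprimeTo) renaming (sym to coprime-sym)
import Data.Nat.ListAction as List
import Data.Nat as ℕ using (_+_; _*_)
import Data.Nat.Properties as ℕ
open import Data.Rational using (mkℚ; _/_; 0ℚ; 1ℚ; -_; nonNegative; nonPositive) renaming (_≤_ to _≤ℚ_)
import Data.Rational.Properties as ℚ
open import Data.Rational.Solver using (module +-*-Solver)
open import Data.Sum using (inj₁; inj₂)
open import Data.Vec.Functional using (Vector; removeAt)
open import Function using (_∘_; id)
open import Relation.Binary.PropositionalEquality
  using (_≡_; refl; sym; trans; cong; cong₂; subst; module ≡-Reasoning)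

module Σℕ = SemiringSum ℕ.+-*-semiring
module Σℚ = SemiringSum (Ring.semiring ℚ.+-*-ring)
open SemiringMult (Ring.semiring ℚ.+-*-ring) using (_×_; ×-homo-+; ×1-homo-*; ×-assoc-*)

ℕ→ℚ≡mkℚ : ∀ n → ℕ→ℚ n ≡ mkℚ (ℤ.+ n) 0 (coprime-sym (1-coprimeTo n))
ℕ→ℚ≡mkℚ n = ℚ.normalize-coprime (coprime-sym (1-coprimeTo n))

-- 1ℚ + mkℚ (+ n) 0 _ computes to (+ 1 + + n * + 1) / 1.
ℕ→ℚ-suc : ∀ n → ℕ→ℚ (suc n) ≡ 1ℚ + ℕ→ℚ n
ℕ→ℚ-suc n = trans (cong (λ x → (ℤ.+ 1 ℤ.+ x) / 1) (sym (ℤ.*-identityʳ (ℤ.+ n))))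
                  (cong (1ℚ +_) (sym (ℕ→ℚ≡mkℚ n)))

ℕ→ℚ≡×1 : ∀ n → ℕ→ℚ n ≡ n × 1ℚ
ℕ→ℚ≡×1 zero    = refl
ℕ→ℚ≡×1 (suc n) = trans (ℕ→ℚ-suc n) (cong (1ℚ +_) (ℕ→ℚ≡×1 n))

ℕ→ℚ-+ : ∀ m n → ℕ→ℚ (m ℕ.+ n) ≡ ℕ→ℚ m + ℕ→ℚ n
ℕ→ℚ-+ m n = begin
  ℕ→ℚ (m ℕ.+ n)      ≡⟨ ℕ→ℚ≡×1 (m ℕ.+ n) ⟩
  (m ℕ.+ n) × 1ℚ     ≡⟨ ×-homo-+ 1ℚ m n ⟩
  m × 1ℚ + n × 1ℚ    ≡⟨ sym (cong₂ _+_ (ℕ→ℚ≡×1 m) (ℕ→ℚ≡×1 n)) ⟩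
  ℕ→ℚ m + ℕ→ℚ n      ∎
  where open ≡-Reasoning

ℕ→ℚ-* : ∀ m n → ℕ→ℚ (m ℕ.* n) ≡ ℕ→ℚ m * ℕ→ℚ n
ℕ→ℚ-* m n = begin
  ℕ→ℚ (m ℕ.* n)        ≡⟨ ℕ→ℚ≡×1 (m ℕ.* n) ⟩
  (m ℕ.* n) × 1ℚ       ≡⟨ ×1-homo-* m n ⟩
  (m × 1ℚ) * (n × 1ℚ)  ≡⟨ sym (cong₂ _*_ (ℕ→ℚ≡×1 m) (ℕ→ℚ≡×1 n)) ⟩
  ℕ→ℚ m * ℕ→ℚ n        ∎
  where open ≡-Reasoning

ℕ→ℚ-*-inverse : ∀ k → ℕ→ℚ (suc k) * (ℤ.+ 1 / suc k) ≡ 1ℚ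
ℕ→ℚ-*-inverse k =
  trans (cong₂ _*_ (ℕ→ℚ≡mkℚ (suc k)) (ℚ.normalize-coprime (1-coprimeTo (suc k))))
        (ℚ.*-inverseʳ (mkℚ (ℤ.+ suc k) 0 (coprime-sym (1-coprimeTo (suc k)))))

ℕ→ℚ-sum : ∀ {n} (f : Fin n → ℕ) → ℕ→ℚ (Σℕ.sum f) ≡ Σℚ.sum (ℕ→ℚ ∘ f)
ℕ→ℚ-sum {zero}  f = refl
ℕ→ℚ-sum {suc n} f = trans (ℕ→ℚ-+ (f zero) (Σℕ.sum (f ∘ suc))) (cong (ℕ→ℚ (f zero) +_) (ℕ→ℚ-sum (f ∘ suc)))

Σᵥ≡sum : ∀ {n} (f : Fin n → ℕ) → Σᵥ f ≡ Σℕ.sum f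
Σᵥ≡sum f = trans (cong List.sum (map-tabulate id f)) (sum-tabulate f)
  where
  sum-tabulate : ∀ {n} (g : Fin n → ℕ) → List.sum (tabulate g) ≡ Σℕ.sum g
  sum-tabulate {zero}  g = refl
  sum-tabulate {suc n} g = cong (g zero ℕ.+_) (sum-tabulate (g ∘ suc))

ℕ→ℚ-Σᵥ : ∀ {n} (f : Fin n → ℕ) → ℕ→ℚ (Σᵥ f) ≡ Σℚ.sum (ℕ→ℚ ∘ f)
ℕ→ℚ-Σᵥ f = trans (cong ℕ→ℚ (Σᵥ≡sum f)) (ℕ→ℚ-sum f)

<ᵇ≡true⇒< : ∀ {a b} → (a <ᵇ b) ≡ true → a < b
<ᵇ≡true⇒< {a} {b} eq = ℕ.<ᵇ⇒< a b (subst T (sym eq) _)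

<ᵇ≡false⇒≥ : ∀ {a b} → (a <ᵇ b) ≡ false → b ≤ a
<ᵇ≡false⇒≥ eq = ℕ.≮⇒≥ (λ a<b → subst T eq (ℕ.<⇒<ᵇ a<b))

module _ {n} (G : SimpleGraph n) where

  arc : Fin n → Fin n → ℕ
  arc i j = ⟦ (toℕ i <ᵇ toℕ j) ∧ adj G i j ⟧

  adj≡arc+arc : ∀ i j → ⟦ adj G i j ⟧ ≡ arc i j ℕ.+ arc j i
  adj≡arc+arc i j with toℕ i <ᵇ toℕ j in i<j | toℕ j <ᵇ toℕ i in j<i
  ... | true  | true  = ⊥-elim (ℕ.<-asym (<ᵇ≡true⇒< {toℕ i} i<j) (<ᵇ≡true⇒< {toℕ j} j<i))
  ... | true  | false = sym (ℕ.+-identityʳ _)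
  ... | false | true  = cong ⟦_⟧ (symm G i j)
  ... | false | false = trans (cong (λ x → ⟦ adj G i x ⟧) (sym i≡j)) (cong ⟦_⟧ (irrefl G i))
    where
    i≡j : i ≡ j
    i≡j = toℕ-injective (ℕ.≤-antisym (<ᵇ≡false⇒≥ j<i) (<ᵇ≡false⇒≥ i<j))

  handshake : Σᵥ (degree G) ≡ 2 ℕ.* edges G
  handshake = begin
    Σᵥ (degree G)                                             ≡⟨ Σᵥ≡sum (degree G) ⟩
    Σℕ.sum (λ i → Σᵥ (λ j → ⟦ adj G i j ⟧))                   ≡⟨ Σℕ.sum-cong-≗ (λ i → Σᵥ≡sum (λ j → ⟦ adj G i j ⟧)) ⟩
    Σℕ.sum (λ i → Σℕ.sum (λ j → ⟦ adj G i j ⟧))               ≡⟨ Σℕ.sum-cong-≗ (λ i → Σℕ.sum-cong-≗ (adj≡arc+arc i)) ⟩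
    Σℕ.sum (λ i → Σℕ.sum (λ j → arc i j ℕ.+ arc j i))         ≡⟨ Σℕ.sum-cong-≗ (λ i → Σℕ.∑-distrib-+ (arc i) (λ j → arc j i)) ⟩
    Σℕ.sum (λ i → Σℕ.sum (arc i) ℕ.+ Σℕ.sum (λ j → arc j i))  ≡⟨ Σℕ.∑-distrib-+ (λ i → Σℕ.sum (arc i)) (λ i → Σℕ.sum (λ j → arc j i)) ⟩
    E ℕ.+ Σℕ.sum (λ i → Σℕ.sum (λ j → arc j i))               ≡⟨ cong (E ℕ.+_) (sym (Σℕ.∑-comm arc)) ⟩
    E ℕ.+ E                                                   ≡⟨ cong (E ℕ.+_) (sym (ℕ.+-identityʳ E)) ⟩
    2 ℕ.* E                                                   ≡⟨ cong (2 ℕ.*_) (sym edges≡E) ⟩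
    2 ℕ.* edges G                                             ∎
    where
    open ≡-Reasoning
    E : ℕ
    E = Σℕ.sum (λ i → Σℕ.sum (arc i))
    edges≡E : edges G ≡ E
    edges≡E = trans (Σᵥ≡sum (λ i → Σᵥ (arc i))) (Σℕ.sum-cong-≗ (λ i → Σᵥ≡sum (arc i)))

  M₁-as-sum : ℕ→ℚ (M₁ G) ≡ Σℚ.sum (λ i → ℕ→ℚ (degree G i) * ℕ→ℚ (degree G i))
  M₁-as-sum = trans (ℕ→ℚ-Σᵥ (λ i → degree G i ℕ.* degree G i))
                    (Σℚ.sum-cong-≗ (λ i → ℕ→ℚ-* (degree G i) (degree G i)))

  2m-as-sum : ℕ→ℚ 2 * ℕ→ℚ (edges G) ≡ Σℚ.sum (ℕ→ℚ ∘ degree G)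
  2m-as-sum = trans (sym (ℕ→ℚ-* 2 (edges G))) (trans (cong ℕ→ℚ (sym handshake)) (ℕ→ℚ-Σᵥ (degree G)))

removeAt-punchOut : ∀ {a} {A : Set a} {n} (t : Vector A (suc n)) {i j : Fin (suc n)} (i≢j : i ≢ j) →
                    removeAt t i (punchOut i≢j) ≡ t j
removeAt-punchOut t i≢j = cong t (punchIn-punchOut i≢j)

punchOut-≢ : ∀ {n} {i j k : Fin (suc n)} (i≢j : i ≢ j) (i≢k : i ≢ k) → j ≢ k → punchOut i≢j ≢ punchOut i≢k
punchOut-≢ i≢j i≢k j≢k eq = j≢k (punchOut-injective i≢j i≢k eq)

module RemoveFour {m} {j k l p : Fin (4 ℕ.+ m)}
  (j≢k : j ≢ k) (j≢l : j ≢ l) (j≢p : j ≢ p) (k≢l : k ≢ l) (k≢p : k ≢ p) (l≢p : l ≢ p) where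

  private
    k₁ l₁ p₁ : Fin (3 ℕ.+ m)
    k₁ = punchOut j≢k
    l₁ = punchOut j≢l
    p₁ = punchOut j≢p

    k₁≢l₁ : k₁ ≢ l₁
    k₁≢l₁ = punchOut-≢ j≢k j≢l k≢l

    k₁≢p₁ : k₁ ≢ p₁
    k₁≢p₁ = punchOut-≢ j≢k j≢p k≢p

    l₂ p₂ : Fin (2 ℕ.+ m)
    l₂ = punchOut k₁≢l₁
    p₂ = punchOut k₁≢p₁

    l₂≢p₂ : l₂ ≢ p₂
    l₂≢p₂ = punchOut-≢ k₁≢l₁ k₁≢p₁ (punchOut-≢ j≢l j≢p l≢p)

    p₃ : Fin (1 ℕ.+ m)
    p₃ = punchOut l₂≢p₂

  rest : ∀ {a} {A : Set a} → Vector A (4 ℕ.+ m) → Vector A m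
  rest t = removeAt (removeAt (removeAt (removeAt t j) k₁) l₂) p₃

  module _ {c ℓ} (M : CommutativeMonoid c ℓ) where
    open CommutativeMonoid M using (Carrier; _≈_; _∙_; ∙-congˡ; setoid)
    open CommutativeMonoidSum M using (sum; sum-remove)
    open import Relation.Binary.Reasoning.Setoid setoid

    sum-remove₄ : (t : Vector Carrier (4 ℕ.+ m)) → sum t ≈ t j ∙ (t k ∙ (t l ∙ (t p ∙ sum (rest t))))
    sum-remove₄ t = begin
      sum t                                             ≈⟨ sum-remove {i = j} t ⟩
      t j ∙ sum t₁                                      ≈⟨ ∙-congˡ (sum-remove {i = k₁} t₁) ⟩
      t j ∙ (t₁ k₁ ∙ sum t₂)                            ≈⟨ ∙-congˡ (∙-congˡ (sum-remove {i = l₂} t₂)) ⟩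
      t j ∙ (t₁ k₁ ∙ (t₂ l₂ ∙ sum t₃))                  ≈⟨ ∙-congˡ (∙-congˡ (∙-congˡ (sum-remove {i = p₃} t₃))) ⟩
      t j ∙ (t₁ k₁ ∙ (t₂ l₂ ∙ (t₃ p₃ ∙ sum (rest t))))  ≡⟨ cong (t j ∙_) (cong₂ _∙_ tk (cong₂ _∙_ tl (cong (_∙ sum (rest t)) tp))) ⟩
      t j ∙ (t k ∙ (t l ∙ (t p ∙ sum (rest t))))        ∎
      where
      t₁ : Vector Carrier (3 ℕ.+ m)
      t₁ = removeAt t j
      t₂ : Vector Carrier (2 ℕ.+ m)
      t₂ = removeAt t₁ k₁
      t₃ : Vector Carrier (1 ℕ.+ m)
      t₃ = removeAt t₂ l₂
      tk : t₁ k₁ ≡ t k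
      tk = removeAt-punchOut t j≢k
      tl : t₂ l₂ ≡ t l
      tl = trans (removeAt-punchOut t₁ k₁≢l₁) (removeAt-punchOut t j≢l)
      tp : t₃ p₃ ≡ t p
      tp = trans (removeAt-punchOut t₂ l₂≢p₂) (trans (removeAt-punchOut t₁ k₁≢p₁) (removeAt-punchOut t j≢p))

open +-*-Solver

x*x-nonneg : ∀ x → 0ℚ ≤ℚ x * x
x*x-nonneg x with ℚ.≤-total 0ℚ x
... | inj₁ 0≤x = ℚ.nonNegative⁻¹ (x * x) {{ℚ.nonNeg*nonNeg⇒nonNeg x {{nonNegative 0≤x}} x {{nonNegative 0≤x}}}}
... | inj₂ x≤0 = ℚ.nonNegative⁻¹ (x * x) {{ℚ.nonPos*nonPos⇒nonPos x {{nonPositive x≤0}} x {{nonPositive x≤0}}}}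

sum-nonneg : ∀ {m} (x : Vector ℚ m) → (∀ i → 0ℚ ≤ℚ x i) → 0ℚ ≤ℚ Σℚ.sum x
sum-nonneg {zero}  x _  = ℚ.≤-refl
sum-nonneg {suc m} x 0≤x = ℚ.+-mono-≤ (0≤x zero) (sum-nonneg (x ∘ suc) (0≤x ∘ suc))

sum-const : ∀ m c → Σℚ.sum {m} (λ _ → c) ≡ ℕ→ℚ m * c
sum-const m c = begin
  Σℚ.sum {m} (λ _ → c)  ≡⟨ Σℚ.sum-replicate m ⟩
  m × c                 ≡⟨ cong (m ×_) (sym (ℚ.*-identityˡ c)) ⟩
  m × (1ℚ * c)          ≡⟨ sym (×-assoc-* m 1ℚ c) ⟩
  (m × 1ℚ) * c          ≡⟨ cong (_* c) (sym (ℕ→ℚ≡×1 m)) ⟩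
  ℕ→ℚ m * c             ∎
  where open ≡-Reasoning

-- The relations r = 1 are imposed on solver identities through explicit multiples of r - 1.
cancel-defect : ∀ {r} x z → r ≡ 1ℚ → x + (r - 1ℚ) * z ≡ x
cancel-defect x z refl = solve 2 (λ x z → x :+ (con 1ℚ :- con 1ℚ) :* z := x) refl x z

sum-sq-deviation : ∀ {m} (x : Vector ℚ m) μ →
  Σℚ.sum (λ i → (x i - μ) * (x i - μ)) ≡ Σℚ.sum (λ i → x i * x i) + (- (μ + μ)) * Σℚ.sum x + ℕ→ℚ m * (μ * μ)
sum-sq-deviation {m} x μ = begin
  Σℚ.sum (λ i → (x i - μ) * (x i - μ))                ≡⟨ Σℚ.sum-cong-≗ expand ⟩
  Σℚ.sum (λ i → x² i + ν * x i + μ * μ)               ≡⟨ Σℚ.∑-distrib-+ (λ i → x² i + ν * x i) (λ _ → μ * μ) ⟩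
  Σℚ.sum (λ i → x² i + ν * x i) + Σℚ.sum {m} (λ _ → μ * μ) ≡⟨ cong₂ _+_ (Σℚ.∑-distrib-+ x² (λ i → ν * x i)) (sum-const m (μ * μ)) ⟩
  Σℚ.sum x² + Σℚ.sum (λ i → ν * x i) + ℕ→ℚ m * (μ * μ) ≡⟨ cong (λ s → Σℚ.sum x² + s + ℕ→ℚ m * (μ * μ)) (sym (Σℚ.*-distribˡ-sum ν x)) ⟩
  Σℚ.sum x² + ν * Σℚ.sum x + ℕ→ℚ m * (μ * μ)          ∎
  where
  open ≡-Reasoning
  ν : ℚ
  ν = - (μ + μ)
  x² : Vector ℚ m
  x² i = x i * x i
  expand : ∀ i → (x i - μ) * (x i - μ) ≡ x² i + ν * x i + μ * μ
  expand i = solve 2 (λ y μ → (y :- μ) :* (y :- μ) := y :* y :+ (:- (μ :+ μ)) :* y :+ μ :* μ) refl (x i) μ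

sum-sq-decomposition : ∀ {m} (x : Vector ℚ m) {κ} → ℕ→ℚ m * κ ≡ 1ℚ →
  let μ = Σℚ.sum x * κ in
  Σℚ.sum (λ i → x i * x i) ≡ Σℚ.sum x * Σℚ.sum x * κ + Σℚ.sum (λ i → (x i - μ) * (x i - μ))
sum-sq-decomposition {m} x {κ} mκ≡1 = sym (begin
  U * U * κ + Σℚ.sum (λ i → (x i - U * κ) * (x i - U * κ))  ≡⟨ cong (U * U * κ +_) (sum-sq-deviation x (U * κ)) ⟩
  U * U * κ + (A + (- (U * κ + U * κ)) * U + M * ((U * κ) * (U * κ)))
     ≡⟨ solve 4 (λ A U M κ → U :* U :* κ :+ (A :+ (:- (U :* κ :+ U :* κ)) :* U :+ M :* ((U :* κ) :* (U :* κ)))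
                        := A :+ (M :* κ :- con 1ℚ) :* (U :* U :* κ)) refl A U M κ ⟩
  A + (M * κ - 1ℚ) * (U * U * κ)                           ≡⟨ cancel-defect A (U * U * κ) mκ≡1 ⟩
  A                                                        ∎)
  where
  open ≡-Reasoning
  U A M : ℚ
  U = Σℚ.sum x
  A = Σℚ.sum (λ i → x i * x i)
  M = ℕ→ℚ m

sum²/m≤sum-sq : ∀ {m} (x : Vector ℚ m) {κ} → ℕ→ℚ m * κ ≡ 1ℚ →
  Σℚ.sum x * Σℚ.sum x * κ ≤ℚ Σℚ.sum (λ i → x i * x i)
sum²/m≤sum-sq x {κ} mκ≡1 = begin
  U * U * κ          ≡⟨ sym (ℚ.+-identityʳ (U * U * κ)) ⟩
  U * U * κ + 0ℚ     ≤⟨ ℚ.+-monoʳ-≤ (U * U * κ) (sum-nonneg deviation² (λ i → x*x-nonneg (x i - U * κ))) ⟩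
  U * U * κ + Σℚ.sum deviation²  ≡⟨ sym (sum-sq-decomposition x mκ≡1) ⟩
  Σℚ.sum (λ i → x i * x i)       ∎
  where
  open ℚ.≤-Reasoning
  U : ℚ
  U = Σℚ.sum x
  deviation² : Vector ℚ _
  deviation² i = (x i - U * κ) * (x i - U * κ)

-- P and Q are the quotients left when the left-hand side is reduced modulo N ν = 1 and K κ = 1.
rhs-collapse : ∀ a b c e U K {twoM N ν κ} →
  twoM ≡ a + (b + (c + (e + U))) → N ≡ K + ℕ→ℚ 2 → N * ν ≡ 1ℚ → K * κ ≡ 1ℚ →
  let S = twoM - a - b
      δ = S * ν - ½ * (c + e) in
  a * a + b * b + (S * S) * ν + ½ * ((c - e) * (c - e)) + ((ℕ→ℚ 2 * N) * κ) * (δ * δ)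
    ≡ a * a + (b * b + (c * c + (e * e + U * U * κ)))
rhs-collapse a b c e U K {ν = ν} {κ} refl refl Nν≡1 Kκ≡1 = begin
  _  ≡⟨ solve 8 (λ a b c e U K ν κ →
          let two = con (ℕ→ℚ 2)
              S = a :+ (b :+ (c :+ (e :+ U))) :- a :- b
              σ = c :+ e :+ U
              δ = S :* ν :- con ½ :* (c :+ e)
          in a :* a :+ b :* b :+ (S :* S) :* ν :+ con ½ :* ((c :- e) :* (c :- e))
               :+ ((two :* (K :+ two)) :* κ) :* (δ :* δ)
             := a :* a :+ (b :* b :+ (c :* c :+ (e :* e :+ U :* U :* κ)))
               :+ ((K :+ two) :* ν :- con 1ℚ) :* (two :* κ :* σ :* σ :* ν :- two :* κ :* σ :* (c :+ e) :+ κ :* σ :* σ)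
               :+ (K :* κ :- con 1ℚ) :* (con ½ :* (c :+ e) :* (c :+ e) :- ν :* σ :* σ))
          refl a b c e U K ν κ ⟩
  R + ((K + two) * ν - 1ℚ) * P + (K * κ - 1ℚ) * Q  ≡⟨ cancel-defect (R + ((K + two) * ν - 1ℚ) * P) Q Kκ≡1 ⟩
  R + ((K + two) * ν - 1ℚ) * P                    ≡⟨ cancel-defect R P Nν≡1 ⟩
  R                                               ∎
  where
  open ≡-Reasoning
  two σ R P Q : ℚ
  two = ℕ→ℚ 2
  σ = c + e + U
  R = a * a + (b * b + (c * c + (e * e + U * U * κ)))
  P = two * κ * σ * σ * ν - two * κ * σ * (c + e) + κ * σ * σ
  Q = ½ * (c + e) * (c + e) - ν * σ * σ

corollary6 : (n : ℕ) → 5 ≤ n → (G : SimpleGraph n) →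
    (∀ i → 0 < degree G i) →
    (j k l p : Fin n) →
    j ≢ k → j ≢ l → j ≢ p → k ≢ l → k ≢ p → l ≢ p →
    let d : Fin n → ℚ
        d i = ℕ→ℚ (degree G i)
        m : ℚ
        m = ℕ→ℚ (edges G)
        S : ℚ
        S = ℕ→ℚ 2 * m - d j - d k
    in ℕ→ℚ (M₁ G) ≥
         d j * d j + d k * d k
         + (S * S) ÷ℕ (n ∸ 2)
         + ½ * ((d l - d p) * (d l - d p))
         + ((ℕ→ℚ 2 * ℕ→ℚ (n ∸ 2)) ÷ℕ (n ∸ 4))
           * ((S ÷ℕ (n ∸ 2) - ½ * (d l + d p)) * (S ÷ℕ (n ∸ 2) - ½ * (d l + d p)))
corollary6 (suc (suc (suc (suc (suc q))))) (s≤s (s≤s (s≤s (s≤s (s≤s z≤n))))) G _ j k l p j≢k j≢l j≢p k≢l k≢p l≢p =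
  begin
  _
    ≡⟨ rhs-collapse (d j) (d k) (d l) (d p) U (ℕ→ℚ (suc q)) 2m≡split N≡K+2 (ℕ→ℚ-*-inverse (2 ℕ.+ q)) (ℕ→ℚ-*-inverse q) ⟩
  d² j + (d² k + (d² l + (d² p + U * U * (ℤ.+ 1 / suc q))))
    ≤⟨ ℚ.+-monoʳ-≤ (d² j) (ℚ.+-monoʳ-≤ (d² k) (ℚ.+-monoʳ-≤ (d² l) (ℚ.+-monoʳ-≤ (d² p)
         (sum²/m≤sum-sq (rest d) (ℕ→ℚ-*-inverse q))))) ⟩
  d² j + (d² k + (d² l + (d² p + Σℚ.sum (rest d²))))   ≡⟨ sym M₁≡split ⟩
  ℕ→ℚ (M₁ G)                                           ∎
  where
  open ℚ.≤-Reasoning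
  open RemoveFour j≢k j≢l j≢p k≢l k≢p l≢p
  d d² : Fin (5 ℕ.+ q) → ℚ
  d i  = ℕ→ℚ (degree G i)
  d² i = d i * d i
  U : ℚ
  U = Σℚ.sum (rest d)
  2m≡split : ℕ→ℚ 2 * ℕ→ℚ (edges G) ≡ d j + (d k + (d l + (d p + U)))
  2m≡split = trans (2m-as-sum G) (sum-remove₄ ℚ.+-0-commutativeMonoid d)
  M₁≡split : ℕ→ℚ (M₁ G) ≡ d² j + (d² k + (d² l + (d² p + Σℚ.sum (rest d²))))
  M₁≡split = trans (M₁-as-sum G) (sum-remove₄ ℚ.+-0-commutativeMonoid d²)
  N≡K+2 : ℕ→ℚ (3 ℕ.+ q) ≡ ℕ→ℚ (suc q) + ℕ→ℚ 2
  N≡K+2 = trans (cong ℕ→ℚ (ℕ.+-comm 2 (suc q))) (ℕ→ℚ-+ (suc q) 2)
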